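{- For every $n\geq 2$, the friendship graph $F_n$ satisfies $B_d^t(F_n)=1$.
   Context: The friendship graph $F_n$ ($n\ge 2$) is obtained by joining $n$ copies of the cycle $C_3$ at a common vertex. A total dominator coloring (TD-coloring) of a graph $G$ with no isolated vertex is a proper vertex coloring of $G$ in which every vertex of $G$ is adjacent to every vertex of some (other) color class. The total dominator chromatic (TDC) number $\chi_d^t(G)$ is the minimum number of color classes in a TD-coloring of $G$. The TDC-bondage number $B_d^t(G)$ of $G$ is the minimum number of edges of $G$ whose removal changes the TDC-number of $G$. -}

module Defs where

open import Data.Nat using (ℕ; _<_)
open import Data.Fin using (Fin)
open import Data.Bool using (Bool)
open import Data.Maybe using (Maybe; just; nothing)
open import Data.Product using (Σ; ∃; _×_; _,_)
open import Data.Sum using (_⊎_; inj₁; inj₂)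
open import Data.Unit using (⊤; tt)
open import Data.Empty using (⊥)
open import Data.List using (List; length)
open import Data.List.Relation.Unary.All using (All)
open import Data.List.Relation.Unary.Any using (Any)
open import Data.List.Relation.Unary.AllPairs using (AllPairs)
open import Relation.Nullary using (¬_)
open import Relation.Binary.PropositionalEquality using (_≡_; _≢_; refl; sym)

record Graph : Set₁ where
  field
    V      : Set
    Adj    : V → V → Set
    Adj-sym    : ∀ {u v} → Adj u v → Adj v u
    Adj-irrefl : ∀ {v} → ¬ Adj v v
open Graph public

record TDColoring (G : Graph) (k : ℕ) : Set where
  field
    col       : V G → Fin k
    surjective : ∀ (j : Fin k) → ∃ λ v → col v ≡ j
    proper    : ∀ u v → Adj G u v → col u ≢ col v
    dominates : ∀ v → ∃ λ (j : Fin k) → ∀ w → col w ≡ j → Adj G v w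

IsTDCNumber : Graph → ℕ → Set
IsTDCNumber G k = TDColoring G k × (∀ k' → k' < k → ¬ TDColoring G k')

-- Edges are given as ordered pairs; two pairs denote the same edge if equal
-- up to swapping.
SameEdge : {A : Set} → A × A → A × A → Set
SameEdge (a , b) (c , d) = (a ≡ c × b ≡ d) ⊎ (a ≡ d × b ≡ c)

removeEdges : (G : Graph) → List (V G × V G) → Graph
removeEdges G es = record
  { V = V G
  ; Adj = λ u v → Adj G u v × ¬ Any (SameEdge (u , v)) es
  ; Adj-sym = λ { {u} {v} (a , n) → Adj-sym G a , λ p → n (flipAny p) }
  ; Adj-irrefl = λ { (a , _) → Adj-irrefl G a }
  }
  where
  open import Data.List.Relation.Unary.Any using (here; there)
  flipSE : ∀ {u v} e → SameEdge (v , u) e → SameEdge (u , v) e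
  flipSE _ (inj₁ (p , q)) = inj₂ (q , p)
  flipSE _ (inj₂ (p , q)) = inj₁ (q , p)
  flipAny : ∀ {u v} {xs : List (V G × V G)} → Any (SameEdge (v , u)) xs → Any (SameEdge (u , v)) xs
  flipAny (here p) = here (flipSE _ p)
  flipAny (there p) = there (flipAny p)

record EdgeSet (G : Graph) (m : ℕ) : Set where
  field
    edges    : List (V G × V G)
    len      : length edges ≡ m
    areEdges : All (λ e → Adj G (Data.Product.proj₁ e) (Data.Product.proj₂ e)) edges
    distinct : AllPairs (λ e f → ¬ SameEdge e f) edges
open EdgeSet public

-- Removing the edges changes the TDC-number of G.
-- (If the resulting graph has no TD-coloring, e.g. it has an isolated vertex,
-- its TDC-number is undefined and this counts as a change.)
ChangesTDC : (G : Graph) → List (V G × V G) → Set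
ChangesTDC G es = ∃ λ k → IsTDCNumber G k × ¬ IsTDCNumber (removeEdges G es) k

IsTDCBondage : Graph → ℕ → Set
IsTDCBondage G m =
  (Σ (EdgeSet G m) λ S → ChangesTDC G (edges S)) ×
  (∀ m' → m' < m → (S : EdgeSet G m') → ¬ ChangesTDC G (edges S))

-- Friendship graph F_n: center `nothing`, and triangle i has outer vertices
-- just (i , false) and just (i , true).
FAdj : {n : ℕ} → Maybe (Fin n × Bool) → Maybe (Fin n × Bool) → Set
FAdj nothing nothing = ⊥
FAdj nothing (just _) = ⊤
FAdj (just _) nothing = ⊤
FAdj (just (i , b)) (just (j , c)) = i ≡ j × b ≢ c

Friendship : ℕ → Graph
Friendship n = record
  { V = Maybe (Fin n × Bool)
  ; Adj = FAdj
  ; Adj-sym = λ { {nothing} {just _} _ → tt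
                ; {just _} {nothing} _ → tt
                ; {just _} {just _} (p , q) → sym p , λ r → q (sym r) }
  ; Adj-irrefl = λ { {nothing} () ; {just _} (_ , q) → q refl }
  }

-- A triangle forces three colours, and colouring the centre 0 and the two outer
-- vertices of every triangle 1 and 2 is a total dominator colouring, so
-- χ_d^t(F_n) = 3.  Removing a spoke c–x leaves x adjacent only to its partner y.
-- In a 3-colouring the three vertices of another triangle carry all colours, so
-- the class dominated by x contains one of them, which is not a neighbour of x:
-- no total dominator 3-colouring survives.  Removing no edge changes nothing.
module Submission where

open import Defs
open import Data.Nat using (ℕ; zero; suc; _≤_; _<_; s≤s)
open import Data.Nat.Properties using (≤⇒≯; 1+n≰n)
open import Data.Fin using (Fin; zero; suc; _≟_)
open import Data.Fin.Properties using (injective⇒≤; any?)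
open import Data.Bool using (true; false)
open import Data.Maybe using (just; nothing)
open import Data.Maybe.Properties using (just-injective)
open import Data.Product using (∃; _×_; _,_; proj₁)
open import Data.Sum using (inj₁; inj₂)
open import Data.Unit using (tt)
open import Data.List using ([]; _∷_)
open import Data.List.Relation.Unary.All using ([]; _∷_)
open import Data.List.Relation.Unary.Any using (here; there)
open import Data.List.Relation.Unary.AllPairs using ([]; _∷_)
open import Data.Vec.Functional using () renaming (_∷_ to _∷ᵛ_)
open import Function using (_∘_)
open import Relation.Nullary using (¬_; yes; no; contradiction)
open import Relation.Binary.PropositionalEquality using (_≡_; _≢_; refl; sym; cong)

distinct⇒≤ : ∀ {m k} (x : Fin m → Fin k) → (∀ {i j} → i ≢ j → x i ≢ x j) → m ≤ k
distinct⇒≤ x distinct = injective⇒≤ injective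
  where
  injective : ∀ {i j} → x i ≡ x j → i ≡ j
  injective {i} {j} eq with i ≟ j
  ... | yes i≡j = i≡j
  ... | no  i≢j = contradiction eq (distinct i≢j)

-- A colour missed by x would extend it to suc k distinct values in Fin k.
distinct⇒surjective : ∀ {k} (x : Fin k → Fin k) → (∀ {i j} → i ≢ j → x i ≢ x j) →
                      ∀ j → ∃ λ i → x i ≡ j
distinct⇒surjective x distinct j with any? (λ i → x i ≟ j)
... | yes hit = hit
... | no  miss = contradiction (distinct⇒≤ (j ∷ᵛ x) extended) 1+n≰n
  where
  extended : ∀ {i i′} → i ≢ i′ → (j ∷ᵛ x) i ≢ (j ∷ᵛ x) i′
  extended {zero}  {zero}   i≢i′ _  = i≢i′ refl
  extended {zero}  {suc i′} _    eq = miss (i′ , sym eq)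
  extended {suc i} {zero}   _    eq = miss (i , eq)
  extended {suc i} {suc i′} i≢i′ eq = distinct (i≢i′ ∘ cong suc) eq

record Clique (G : Graph) (m : ℕ) : Set where
  field
    vertex   : Fin m → V G
    adjacent : ∀ {i j} → i ≢ j → Adj G (vertex i) (vertex j)
open Clique

module _ {G : Graph} where

  clique-size≤colours : ∀ {m k} (col : V G → Fin k) →
                        (∀ u v → Adj G u v → col u ≢ col v) → Clique G m → m ≤ k
  clique-size≤colours col proper K =
    distinct⇒≤ (col ∘ vertex K) (proper _ _ ∘ adjacent K)

  clique⇒no-smaller-TDColoring : ∀ {m} → Clique G m → ∀ k → k < m → ¬ TDColoring G k
  clique⇒no-smaller-TDColoring K k k<m c =
    ≤⇒≯ (clique-size≤colours (TDColoring.col c) (TDColoring.proper c) K) k<m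

  -- A clique with as many vertices as colours meets every class, in particular the one v dominates.
  TDColoring⇒adjacent-to-clique : ∀ {k} → TDColoring G k → (K : Clique G k) →
                                  ∀ v → ∃ λ i → Adj G v (vertex K i)
  TDColoring⇒adjacent-to-clique c K v =
    let open TDColoring c
        (j , dominated) = dominates v
        (i , colᵢ≡j)    = distinct⇒surjective (col ∘ vertex K)
                            (proper _ _ ∘ adjacent K) j
    in i , dominated (vertex K i) colᵢ≡j

  removeEdges-[]⁺ : ∀ {k} → TDColoring G k → TDColoring (removeEdges G []) k
  removeEdges-[]⁺ c = record
    { col        = col
    ; surjective = surjective
    ; proper     = λ u v adj → proper u v (proj₁ adj)
    ; dominates  = λ v → let (j , dominated) = dominates v
                         in j , λ w eq → dominated w eq , λ ()
    }
    where open TDColoring c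

  removeEdges-[]⁻ : ∀ {k} → TDColoring (removeEdges G []) k → TDColoring G k
  removeEdges-[]⁻ c = record
    { col        = col
    ; surjective = surjective
    ; proper     = λ u v adj → proper u v (adj , λ ())
    ; dominates  = λ v → let (j , dominated) = dominates v
                         in j , λ w eq → proj₁ (dominated w eq)
    }
    where open TDColoring c

  ¬ChangesTDC-[] : ¬ ChangesTDC G []
  ¬ChangesTDC-[] (k , (c , minimal) , unchanged) =
    unchanged (removeEdges-[]⁺ c , λ k′ k′<k c′ → minimal k′ k′<k (removeEdges-[]⁻ c′))

  ¬ChangesTDC-EdgeSet-0 : (S : EdgeSet G 0) → ¬ ChangesTDC G (edges S)
  ¬ChangesTDC-EdgeSet-0 record { edges = [] } = ¬ChangesTDC-[]

  removeEdge-away : ∀ {a b u v} → Adj G u v → u ≢ a → v ≢ a →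
                    Adj (removeEdges G ((a , b) ∷ [])) u v
  removeEdge-away adj u≢a v≢a = adj , λ
    { (here (inj₁ (u≡a , _))) → u≢a u≡a
    ; (here (inj₂ (_ , v≡a))) → v≢a v≡a
    ; (there ())
    }

  Clique-removeEdge : ∀ {m a b} (K : Clique G m) → (∀ i → vertex K i ≢ a) →
                      Clique (removeEdges G ((a , b) ∷ [])) m
  Clique-removeEdge K avoids = record
    { vertex   = vertex K
    ; adjacent = λ {i} {j} i≢j → removeEdge-away (adjacent K i≢j) (avoids i) (avoids j)
    }

module _ {n : ℕ} where

  triangle : Fin n → Clique (Friendship n) 3
  triangle i = record { vertex = corner ; adjacent = adjacent-corners }
    where
    corner : Fin 3 → V (Friendship n)
    corner zero             = nothing
    corner (suc zero)       = just (i , false)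
    corner (suc (suc zero)) = just (i , true)

    adjacent-corners : ∀ {a b} → a ≢ b → Adj (Friendship n) (corner a) (corner b)
    adjacent-corners {zero}           {zero}           a≢b = contradiction refl a≢b
    adjacent-corners {zero}           {suc zero}       _   = tt
    adjacent-corners {zero}           {suc (suc zero)} _   = tt
    adjacent-corners {suc zero}       {zero}           _   = tt
    adjacent-corners {suc zero}       {suc zero}       a≢b = contradiction refl a≢b
    adjacent-corners {suc zero}       {suc (suc zero)} _   = refl , λ ()
    adjacent-corners {suc (suc zero)} {zero}           _   = tt
    adjacent-corners {suc (suc zero)} {suc zero}       _   = refl , λ ()
    adjacent-corners {suc (suc zero)} {suc (suc zero)} a≢b = contradiction refl a≢b

  sideColour : V (Friendship n) → Fin 3
  sideColour nothing            = zero
  sideColour (just (_ , false)) = suc zero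
  sideColour (just (_ , true))  = suc (suc zero)

  sideColour-proper : ∀ u v → Adj (Friendship n) u v → sideColour u ≢ sideColour v
  sideColour-proper nothing            (just (_ , false)) _        ()
  sideColour-proper nothing            (just (_ , true))  _        ()
  sideColour-proper (just (_ , false)) nothing            _        ()
  sideColour-proper (just (_ , true))  nothing            _        ()
  sideColour-proper (just (_ , false)) (just (_ , false)) (_ , b≢c) _ = b≢c refl
  sideColour-proper (just (_ , false)) (just (_ , true))  _        ()
  sideColour-proper (just (_ , true))  (just (_ , false)) _        ()
  sideColour-proper (just (_ , true))  (just (_ , true))  (_ , b≢c) _ = b≢c refl

  sideColour-dominates : ∀ v → ∃ λ j → ∀ w → sideColour w ≡ j → Adj (Friendship n) v w
  sideColour-dominates nothing  = suc zero , λ { nothing () ; (just _) _ → tt }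
  sideColour-dominates (just _) = zero , λ
    { nothing _ → tt ; (just (_ , false)) () ; (just (_ , true)) () }

  triangle-avoids-side : ∀ {i j} → i ≢ j → ∀ b k → vertex (triangle j) k ≢ just (i , b)
  triangle-avoids-side _   _ zero             ()
  triangle-avoids-side i≢j _ (suc zero)       eq = i≢j (sym (cong proj₁ (just-injective eq)))
  triangle-avoids-side i≢j _ (suc (suc zero)) eq = i≢j (sym (cong proj₁ (just-injective eq)))

  spoke : Fin n → V (Friendship n) × V (Friendship n)
  spoke i = just (i , false) , nothing

  spoke-removed-pendant : ∀ {i} w →
                          Adj (removeEdges (Friendship n) (spoke i ∷ [])) (just (i , false)) w →
                          w ≡ just (i , true)
  spoke-removed-pendant nothing            (_ , not-removed)         =
    contradiction (here (inj₁ (refl , refl))) not-removed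
  spoke-removed-pendant (just (_ , false)) ((_ , false≢false) , _) = contradiction refl false≢false
  spoke-removed-pendant (just (_ , true))  ((refl , _) , _)          = refl

  ¬TDColoring-spoke-removed : ∀ {i j} → i ≢ j →
                              ¬ TDColoring (removeEdges (Friendship n) (spoke i ∷ [])) 3
  ¬TDColoring-spoke-removed {i} {j} i≢j c =
    let K         = Clique-removeEdge (triangle j) (triangle-avoids-side i≢j false)
        (k , adj) = TDColoring⇒adjacent-to-clique c K (just (i , false))
    in triangle-avoids-side i≢j true k (spoke-removed-pendant _ adj)

sideColouring : ∀ {n} → TDColoring (Friendship (suc n)) 3
sideColouring = record
  { col        = sideColour
  ; surjective = λ { zero             → nothing , refl
                   ; (suc zero)       → just (zero , false) , refl
                   ; (suc (suc zero)) → just (zero , true) , refl }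
  ; proper     = sideColour-proper
  ; dominates  = sideColour-dominates
  }

χ-Friendship : ∀ {n} → IsTDCNumber (Friendship (suc n)) 3
χ-Friendship = sideColouring , clique⇒no-smaller-TDColoring (triangle zero)

spokeSet : ∀ {n} → Fin n → EdgeSet (Friendship n) 1
spokeSet i = record
  { edges = spoke i ∷ [] ; len = refl ; areEdges = tt ∷ [] ; distinct = [] ∷ [] }

theorem4p10 : ∀ (n : ℕ) → 2 ≤ n → IsTDCBondage (Friendship n) 1
theorem4p10 (suc zero) (s≤s ())
theorem4p10 (suc (suc _)) _ =
  (spokeSet zero , 3 , χ-Friendship ,
    λ χ′ → ¬TDColoring-spoke-removed {j = suc zero} (λ ()) (proj₁ χ′)) ,
  λ { zero _ S → ¬ChangesTDC-EdgeSet-0 S ; (suc _) (s≤s ()) _ }
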